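{- For every integer $n\ge 1$, $$E_{2n}=(2n)!\sum_{t_1+2t_2+\cdots+nt_n=n}\binom{t_1+\cdots+t_n}{t_1,\dots,t_n}(-1)^{t_1+\cdots+t_n}\left(\frac{1}{2!}\right)^{t_1}\left(\frac{1}{4!}\right)^{t_2}\cdots\left(\frac{1}{(2n)!}\right)^{t_n},$$ the sum running over tuples of nonnegative integers $(t_1,\dots,t_n)$ with $t_1+2t_2+\cdots+nt_n=n$. Moreover, $$\frac{(-1)^n}{(2n)!}=\det M_n,$$ where $M_n$ is the $n\times n$ matrix with $(M_n)_{i,j}=\frac{E_{2(i-j+1)}}{(2(i-j+1))!}$ for $i\ge j$, $(M_n)_{i,i+1}=1$, and $(M_n)_{i,j}=0$ for $j>i+1$.
   Context: $E_n$ are the classical Euler numbers, $\frac{1}{\cosh t}=\sum_{n\ge0}E_n\frac{t^n}{n!}$. $\binom{t_1+\cdots+t_n}{t_1,\dots,t_n}=\frac{(t_1+\cdots+t_n)!}{t_1!\cdots t_n!}$. -}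

module Defs where

open import Data.Nat as ℕ using (ℕ; zero; suc; _!; _≟_)
open import Data.Nat.Properties using (_!≢0)
open import Data.Integer using (+_)
open import Data.Rational using (ℚ; 0ℚ; 1ℚ; -_; _+_; _*_; _/_)
open import Data.List using (List; []; _∷_; map; zipWith; filter; foldr; concatMap; upTo)
open import Data.Vec as Vec using (Vec; []; _∷_; lookup)
open import Data.Fin using (Fin; zero; suc; toℕ; punchIn)
open import Relation.Nullary.Decidable using (Dec; yes; no)
open import Data.Bool using (Bool; true; false; if_then_else_; not)

ℕ→ℚ : ℕ → ℚ
ℕ→ℚ n = (+ n) / 1

invFact : ℕ → ℚ
invFact m = ((+ 1) / (m !)) {{m !≢0}}

_^ℚ_ : ℚ → ℕ → ℚ
q ^ℚ zero = 1ℚ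
q ^ℚ suc k = q * (q ^ℚ k)

sumℚ : List ℚ → ℚ
sumℚ = foldr _+_ 0ℚ

prodℚ : List ℚ → ℚ
prodℚ = foldr _*_ 1ℚ

-- Formal power series (coefficient sequences ℕ → ℚ) and the
-- multiplicative inverse of a series with constant term 1:
--   b₀ = 1,  b_m = - Σ_{k=1}^{m} a_k b_{m-k}.

-- invList a m = [ b_m , b_{m-1} , … , b_0 ]
invList : (ℕ → ℚ) → ℕ → List ℚ
invList a zero = 1ℚ ∷ []
invList a (suc m) =
  let prev = invList a m in
  (- sumℚ (zipWith _*_ (map (λ k → a (suc k)) (upTo (suc m))) prev)) ∷ prev

headℚ : List ℚ → ℚ
headℚ [] = 0ℚ
headℚ (x ∷ _) = x

-- coefficient of t^m in 1 / (Σ a_k t^k), assuming a 0 = 1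
invSeries : (ℕ → ℚ) → ℕ → ℚ
invSeries a m = headℚ (invList a m)

isEven : ℕ → Bool
isEven zero = true
isEven (suc k) = not (isEven k)

coshCoeff : ℕ → ℚ
coshCoeff k = if isEven k then invFact k else 0ℚ

-- Euler numbers: 1/cosh t = Σ E_n t^n / n!
Euler : ℕ → ℚ
Euler n = ℕ→ℚ (n !) * invSeries coshCoeff n

allVecs : (b k : ℕ) → List (Vec ℕ k)
allVecs b zero = [] ∷ []
allVecs b (suc k) = concatMap (λ x → map (x ∷_) (allVecs b k)) (upTo (suc b))

-- weighted sum Σ_{i} (i+s) t_i  (1-based weights when s = 1)
wsum : ∀ {k} → ℕ → Vec ℕ k → ℕ
wsum s [] = 0
wsum s (t ∷ ts) = s ℕ.* t ℕ.+ wsum (suc s) ts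

-- tuples with t₁ + 2t₂ + ⋯ + n t_n = n  (each t_i ≤ n necessarily)
tuples : (n : ℕ) → List (Vec ℕ n)
tuples n = filter (λ t → wsum 1 t ≟ n) (allVecs n n)

summand : (n : ℕ) → Vec ℕ n → ℚ
summand n t =
  ℕ→ℚ (Vec.sum t !) * prodℚ (Vec.toList (Vec.map invFact t))
  * ((- 1ℚ) ^ℚ Vec.sum t)
  * prodℚ (Vec.toList (Vec.zipWith (λ i ti → invFact (2 ℕ.* i) ^ℚ ti)
                                    (Vec.tabulate (λ (j : Fin n) → suc (toℕ j))) t))

det : (n : ℕ) → (Fin n → Fin n → ℚ) → ℚ
det zero M = 1ℚ
det (suc n) M = sumℚ (Vec.toList (Vec.tabulate (λ j →
  ((- 1ℚ) ^ℚ toℕ j) * M zero j * det n (λ i k → M (suc i) (punchIn j k)))))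

-- The matrix M_n (0-based indices i, j ∈ Fin n; same as 1-based since
-- only i - j matters):
--   E_{2(i-j+1)}/(2(i-j+1))!  if i ≥ j,   1 if j = i+1,   0 if j > i+1.
Mmat : (n : ℕ) → Fin n → Fin n → ℚ
Mmat n i j with toℕ j ℕ.≤? toℕ i
... | yes _ = let m = 2 ℕ.* (toℕ i ℕ.∸ toℕ j ℕ.+ 1) in Euler m * invFact m
... | no _ with toℕ j ≟ suc (toℕ i)
...   | yes _ = 1ℚ
...   | no _ = 0ℚ

{-# OPTIONS --safe #-}
-- Write aₖ = 1/(2k)!, so that cosh √t = Σ aₖ tᵏ. As cosh is even, E₂ₙ/(2n)! is the n-th
-- coefficient cₙ of 1/cosh √t, that is c₀ = 1 and cₙ₊₁ = - Σ_{i ≤ n} aᵢ₊₁ cₙ₋ᵢ. The sum over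
-- tuples (partitions of n with tᵢ parts equal to i) satisfies the same recurrence: splitting
-- (Σ t)! = Σⱼ tⱼ (Σ t - 1)! and absorbing tⱼ into 1/tⱼ! removes one part j. Expanding the
-- Hessenberg determinant det (c_{i-j+1}) along its first row, the recurrence collapses the
-- cofactor expansion to (-1)ⁿ aₙ.
module Submission where

open import Defs
open import Data.Nat using (ℕ; suc; _*_; _!; _≤_)
open import Data.Rational using (ℚ; 1ℚ; -_) renaming (_*_ to _*ℚ_)
open import Data.List using (map)
open import Data.Product using (_×_)
open import Relation.Binary.PropositionalEquality using (_≡_)

open import Data.Nat using (zero; _+_; _∸_; _<_; z≤n; s≤s; _≟_; _≤?_; NonZero; >-nonZero)
import Data.Nat.Properties as ℕ
open import Data.Nat.Properties using (_!≢0)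
open import Data.Nat.Induction using (<-rec)
import Data.Nat.Solver as ℕ-Solver
open import Data.Nat.Coprimality using (1-coprimeTo) renaming (sym to coprime-sym)
import Data.Integer as ℤ
import Data.Integer.Properties as ℤ
open import Data.Rational using (mkℚ; 0ℚ; toℚᵘ; _/_) renaming (_+_ to _+ℚ_)
import Data.Rational.Properties as ℚ
import Data.Rational.Unnormalised as ℚᵘ
import Data.Rational.Unnormalised.Properties as ℚᵘ
open import Data.Rational.Solver using (module +-*-Solver)
open import Data.List as List using (List; []; _∷_; applyUpTo; upTo; zipWith; concatMap; filter; _++_)
import Data.List.Properties as List
open import Data.Vec as Vec using (Vec; []; _∷_)
import Data.Vec.Properties as Vec
open import Data.Fin using (Fin; toℕ; punchIn) renaming (zero to fzero; suc to fsuc)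
open import Data.Bool using (true; not)
open import Data.Empty using (⊥-elim)
open import Data.Sum using (inj₁; inj₂)
open import Data.Product using (_,_)
open import Relation.Nullary using (¬_; Dec; yes; no)
open import Relation.Binary.PropositionalEquality
  using (refl; sym; trans; cong; cong₂; subst; module ≡-Reasoning)

open import Algebra.Properties.Group ℚ.+-0-group using (inverseˡ-unique)

module ℕS = ℕ-Solver.+-*-Solver
open +-*-Solver using (solve; _:+_; _:*_; :-_; _:=_; con)

-- Rational arithmetic

ℕ→ℚ-mkℚ : ∀ n → ℕ→ℚ n ≡ mkℚ (ℤ.+ n) 0 (coprime-sym (1-coprimeTo n))
ℕ→ℚ-mkℚ n = ℚ.normalize-coprime (coprime-sym (1-coprimeTo n))

ℕ→ℚ-suc : ∀ n → ℕ→ℚ (suc n) ≡ 1ℚ +ℚ ℕ→ℚ n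
ℕ→ℚ-suc n = ℚ.toℚᵘ-injective (ℚᵘ.≃-trans (ℚᵘ.≃-reflexive (cong toℚᵘ (ℕ→ℚ-mkℚ (suc n))))
  (ℚᵘ.≃-trans unnormalised (ℚᵘ.≃-sym (ℚ.toℚᵘ-homo-+ 1ℚ (ℕ→ℚ n)))))
  where
  unnormalised : ℚᵘ.mkℚᵘ (ℤ.+ suc n) 0 ℚᵘ.≃ toℚᵘ 1ℚ ℚᵘ.+ toℚᵘ (ℕ→ℚ n)
  unnormalised rewrite ℕ→ℚ-mkℚ n =
    ℚᵘ.*≡* (cong (ℤ._* ℤ.+ 1) (cong ℤ.suc (sym (ℤ.*-identityʳ (ℤ.+ n)))))

ℕ→ℚ-+ : ∀ m n → ℕ→ℚ (m + n) ≡ ℕ→ℚ m +ℚ ℕ→ℚ n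
ℕ→ℚ-+ zero    n = sym (ℚ.+-identityˡ (ℕ→ℚ n))
ℕ→ℚ-+ (suc m) n = begin
  ℕ→ℚ (suc (m + n))            ≡⟨ ℕ→ℚ-suc (m + n) ⟩
  1ℚ +ℚ ℕ→ℚ (m + n)            ≡⟨ cong (1ℚ +ℚ_) (ℕ→ℚ-+ m n) ⟩
  1ℚ +ℚ (ℕ→ℚ m +ℚ ℕ→ℚ n)       ≡⟨ ℚ.+-assoc 1ℚ (ℕ→ℚ m) (ℕ→ℚ n) ⟨
  (1ℚ +ℚ ℕ→ℚ m) +ℚ ℕ→ℚ n       ≡⟨ cong (_+ℚ ℕ→ℚ n) (ℕ→ℚ-suc m) ⟨
  ℕ→ℚ (suc m) +ℚ ℕ→ℚ n         ∎
  where open ≡-Reasoning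

ℕ→ℚ-* : ∀ m n → ℕ→ℚ (m * n) ≡ ℕ→ℚ m *ℚ ℕ→ℚ n
ℕ→ℚ-* zero    n = sym (ℚ.*-zeroˡ (ℕ→ℚ n))
ℕ→ℚ-* (suc m) n = begin
  ℕ→ℚ (n + m * n)                     ≡⟨ ℕ→ℚ-+ n (m * n) ⟩
  ℕ→ℚ n +ℚ ℕ→ℚ (m * n)                ≡⟨ cong (ℕ→ℚ n +ℚ_) (ℕ→ℚ-* m n) ⟩
  ℕ→ℚ n +ℚ ℕ→ℚ m *ℚ ℕ→ℚ n             ≡⟨ solve 2 (λ x y → x :+ y :* x := (con 1ℚ :+ y) :* x) refl (ℕ→ℚ n) (ℕ→ℚ m) ⟩
  (1ℚ +ℚ ℕ→ℚ m) *ℚ ℕ→ℚ n              ≡⟨ cong (_*ℚ ℕ→ℚ n) (ℕ→ℚ-suc m) ⟨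
  ℕ→ℚ (suc m) *ℚ ℕ→ℚ n                ∎
  where open ≡-Reasoning

ℕ→ℚ-!*invFact : ∀ n → ℕ→ℚ (n !) *ℚ invFact n ≡ 1ℚ
ℕ→ℚ-!*invFact n = inverse (n !) {{n !≢0}}
  where
  inverse : ∀ d .{{_ : NonZero d}} → ℕ→ℚ d *ℚ ((ℤ.+ 1) / d) ≡ 1ℚ
  inverse (suc d) = trans (cong₂ _*ℚ_ (ℕ→ℚ-mkℚ (suc d)) (ℚ.normalize-coprime (1-coprimeTo (suc d))))
                          (ℚ.*-inverseʳ (mkℚ (ℤ.+ suc d) 0 (coprime-sym (1-coprimeTo (suc d)))))

ℕ→ℚ-suc*invFact-suc : ∀ n → ℕ→ℚ (suc n) *ℚ invFact (suc n) ≡ invFact n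
ℕ→ℚ-suc*invFact-suc n = begin
  A *ℚ B                          ≡⟨ ℚ.*-identityʳ (A *ℚ B) ⟨
  (A *ℚ B) *ℚ 1ℚ                  ≡⟨ cong ((A *ℚ B) *ℚ_) (ℕ→ℚ-!*invFact n) ⟨
  (A *ℚ B) *ℚ (C *ℚ D)            ≡⟨ solve 4 (λ A B C D → (A :* B) :* (C :* D) := ((A :* C) :* B) :* D) refl A B C D ⟩
  ((A *ℚ C) *ℚ B) *ℚ D            ≡⟨ cong (λ z → (z *ℚ B) *ℚ D) (ℕ→ℚ-* (suc n) (n !)) ⟨
  (ℕ→ℚ (suc n !) *ℚ B) *ℚ D       ≡⟨ cong (_*ℚ D) (ℕ→ℚ-!*invFact (suc n)) ⟩
  1ℚ *ℚ D                         ≡⟨ ℚ.*-identityˡ D ⟩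
  D                               ∎
  where
  open ≡-Reasoning
  A = ℕ→ℚ (suc n)
  B = invFact (suc n)
  C = ℕ→ℚ (n !)
  D = invFact n

^ℚ-+ : ∀ q m n → q ^ℚ (m + n) ≡ q ^ℚ m *ℚ q ^ℚ n
^ℚ-+ q zero    n = sym (ℚ.*-identityˡ (q ^ℚ n))
^ℚ-+ q (suc m) n = trans (cong (q *ℚ_) (^ℚ-+ q m n)) (sym (ℚ.*-assoc q (q ^ℚ m) (q ^ℚ n)))

-- Finite sums

∑ : ℕ → (ℕ → ℚ) → ℚ
∑ zero    f = 0ℚ
∑ (suc n) f = f 0 +ℚ ∑ n (λ i → f (suc i))

syntax ∑ n (λ i → e) = ∑[ i < n ] e

∑-cong : ∀ n {f g : ℕ → ℚ} → (∀ i → i < n → f i ≡ g i) → ∑ n f ≡ ∑ n g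
∑-cong zero    f≗g = refl
∑-cong (suc n) f≗g = cong₂ _+ℚ_ (f≗g 0 (s≤s z≤n)) (∑-cong n (λ i i<n → f≗g (suc i) (s≤s i<n)))

∑-zero : ∀ n {f : ℕ → ℚ} → (∀ i → i < n → f i ≡ 0ℚ) → ∑ n f ≡ 0ℚ
∑-zero zero    f≗0 = refl
∑-zero (suc n) f≗0 = trans (cong₂ _+ℚ_ (f≗0 0 (s≤s z≤n)) (∑-zero n (λ i i<n → f≗0 (suc i) (s≤s i<n))))
                           (ℚ.+-identityˡ 0ℚ)

∑-+ : ∀ m n f → ∑ (m + n) f ≡ ∑ m f +ℚ ∑[ i < n ] f (m + i)
∑-+ zero    n f = sym (ℚ.+-identityˡ (∑ n f))
∑-+ (suc m) n f = trans (cong (f 0 +ℚ_) (∑-+ m n (λ i → f (suc i)))) (sym (ℚ.+-assoc (f 0) _ _))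

∑-last : ∀ n f → ∑ (suc n) f ≡ ∑ n f +ℚ f n
∑-last n f = trans (cong (λ k → ∑ k f) (ℕ.+-comm 1 n))
  (trans (∑-+ n 1 f) (cong (∑ n f +ℚ_) (trans (ℚ.+-identityʳ (f (n + 0))) (cong f (ℕ.+-identityʳ n)))))

∑-distrib-+ : ∀ n f g → ∑[ i < n ] (f i +ℚ g i) ≡ ∑ n f +ℚ ∑ n g
∑-distrib-+ zero    f g = refl
∑-distrib-+ (suc n) f g = trans (cong ((f 0 +ℚ g 0) +ℚ_) (∑-distrib-+ n _ _))
  (solve 4 (λ a b c d → (a :+ b) :+ (c :+ d) := (a :+ c) :+ (b :+ d)) refl (f 0) (g 0) _ _)

*-distribˡ-∑ : ∀ n c f → c *ℚ ∑ n f ≡ ∑[ i < n ] (c *ℚ f i)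
*-distribˡ-∑ zero    c f = ℚ.*-zeroʳ c
*-distribˡ-∑ (suc n) c f = trans (ℚ.*-distribˡ-+ c (f 0) _) (cong (c *ℚ f 0 +ℚ_) (*-distribˡ-∑ n c _))

neg-distrib-∑ : ∀ n f → - ∑ n f ≡ ∑[ i < n ] (- f i)
neg-distrib-∑ zero    f = refl
neg-distrib-∑ (suc n) f = trans (ℚ.neg-distrib-+ (f 0) _) (cong (- f 0 +ℚ_) (neg-distrib-∑ n _))

∑-comm : ∀ m n (f : ℕ → ℕ → ℚ) → ∑[ i < m ] ∑[ j < n ] f i j ≡ ∑[ j < n ] ∑[ i < m ] f i j
∑-comm zero    n f = sym (∑-zero n (λ _ _ → refl))
∑-comm (suc m) n f = trans (cong (∑ n (f 0) +ℚ_) (∑-comm m n (λ i → f (suc i))))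
  (sym (∑-distrib-+ n (f 0) (λ j → ∑[ i < m ] f (suc i) j)))

2*suc : ∀ k → 2 * suc k ≡ suc (suc (2 * k))
2*suc k = cong suc (ℕ.+-suc k (k + 0))

∑-evenOdd : ∀ n f → ∑ (2 * n) f ≡ ∑[ i < n ] (f (2 * i) +ℚ f (suc (2 * i)))
∑-evenOdd zero    f = refl
∑-evenOdd (suc n) f = begin
  ∑ (2 * suc n) f                                           ≡⟨ cong (λ k → ∑ k f) (2*suc n) ⟩
  f 0 +ℚ (f 1 +ℚ ∑[ i < 2 * n ] f (2 + i))                  ≡⟨ ℚ.+-assoc (f 0) (f 1) _ ⟨
  (f 0 +ℚ f 1) +ℚ ∑[ i < 2 * n ] f (2 + i)                  ≡⟨ cong ((f 0 +ℚ f 1) +ℚ_) (∑-evenOdd n (λ i → f (2 + i))) ⟩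
  (f 0 +ℚ f 1) +ℚ ∑[ i < n ] (f (2 + 2 * i) +ℚ f (3 + 2 * i)) ≡⟨ cong ((f 0 +ℚ f 1) +ℚ_) (∑-cong n shift) ⟩
  ∑[ i < suc n ] (f (2 * i) +ℚ f (suc (2 * i)))             ∎
  where
  open ≡-Reasoning
  shift : ∀ i → i < n → f (2 + 2 * i) +ℚ f (3 + 2 * i) ≡ f (2 * suc i) +ℚ f (suc (2 * suc i))
  shift i _ = cong₂ (λ u v → f u +ℚ f v) (sym (2*suc i)) (cong suc (sym (2*suc i)))

sumℚ-++ : ∀ xs ys → sumℚ (xs ++ ys) ≡ sumℚ xs +ℚ sumℚ ys
sumℚ-++ []       ys = sym (ℚ.+-identityˡ (sumℚ ys))
sumℚ-++ (x ∷ xs) ys = trans (cong (x +ℚ_) (sumℚ-++ xs ys)) (sym (ℚ.+-assoc x (sumℚ xs) (sumℚ ys)))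

sumℚ-applyUpTo : ∀ n f → sumℚ (applyUpTo f n) ≡ ∑ n f
sumℚ-applyUpTo zero    f = refl
sumℚ-applyUpTo (suc n) f = cong (f 0 +ℚ_) (sumℚ-applyUpTo n (λ i → f (suc i)))

sumℚ-map-upTo : ∀ n f → sumℚ (map f (upTo n)) ≡ ∑ n f
sumℚ-map-upTo n f = trans (cong sumℚ (List.map-applyUpTo (λ i → i) f n)) (sumℚ-applyUpTo n f)

sumℚ-map-concatMap : ∀ {A B : Set} (g : A → List B) (f : B → ℚ) xs →
  sumℚ (map f (concatMap g xs)) ≡ sumℚ (map (λ x → sumℚ (map f (g x))) xs)
sumℚ-map-concatMap g f []       = refl
sumℚ-map-concatMap g f (x ∷ xs) = begin
  sumℚ (map f (g x ++ concatMap g xs))                   ≡⟨ cong sumℚ (List.map-++ f (g x) (concatMap g xs)) ⟩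
  sumℚ (map f (g x) ++ map f (concatMap g xs))           ≡⟨ sumℚ-++ (map f (g x)) _ ⟩
  sumℚ (map f (g x)) +ℚ sumℚ (map f (concatMap g xs))    ≡⟨ cong (sumℚ (map f (g x)) +ℚ_) (sumℚ-map-concatMap g f xs) ⟩
  sumℚ (map f (g x)) +ℚ sumℚ (map (λ x → sumℚ (map f (g x))) xs) ∎
  where open ≡-Reasoning

*-distribˡ-sumℚ-map : ∀ {A : Set} c (f : A → ℚ) xs → c *ℚ sumℚ (map f xs) ≡ sumℚ (map (λ x → c *ℚ f x) xs)
*-distribˡ-sumℚ-map c f []       = ℚ.*-zeroʳ c
*-distribˡ-sumℚ-map c f (x ∷ xs) =
  trans (ℚ.*-distribˡ-+ c (f x) _) (cong (c *ℚ f x +ℚ_) (*-distribˡ-sumℚ-map c f xs))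

𝟙 : ∀ {P : Set} → Dec P → ℚ
𝟙 (yes _) = 1ℚ
𝟙 (no _)  = 0ℚ

𝟙-no : ∀ {P : Set} (P? : Dec P) → ¬ P → 𝟙 P? ≡ 0ℚ
𝟙-no (yes p) ¬p = ⊥-elim (¬p p)
𝟙-no (no _)  ¬p = refl

𝟙-⇔ : ∀ {P Q : Set} (P? : Dec P) (Q? : Dec Q) → (P → Q) → (Q → P) → 𝟙 P? ≡ 𝟙 Q?
𝟙-⇔ (yes _) (yes _) P→Q Q→P = refl
𝟙-⇔ (no _)  (no _)  P→Q Q→P = refl
𝟙-⇔ (yes p) (no ¬q) P→Q Q→P = ⊥-elim (¬q (P→Q p))
𝟙-⇔ (no ¬p) (yes q) P→Q Q→P = ⊥-elim (¬p (Q→P q))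

sumℚ-map-filter : ∀ {A : Set} {P : A → Set} (P? : ∀ x → Dec (P x)) (f : A → ℚ) xs →
  sumℚ (map f (filter P? xs)) ≡ sumℚ (map (λ x → 𝟙 (P? x) *ℚ f x) xs)
sumℚ-map-filter P? f []       = refl
sumℚ-map-filter P? f (x ∷ xs) with P? x
... | yes _ = cong₂ _+ℚ_ (sym (ℚ.*-identityˡ (f x))) (sumℚ-map-filter P? f xs)
... | no _  = trans (sumℚ-map-filter P? f xs)
  (sym (trans (cong (_+ℚ _) (ℚ.*-zeroˡ (f x))) (ℚ.+-identityˡ _)))

-- Inverse power series

sumℚ-zipWith-invList : ∀ a f m →
  sumℚ (zipWith _*ℚ_ (applyUpTo f (suc m)) (invList a m)) ≡ ∑[ k < suc m ] (f k *ℚ invSeries a (m ∸ k))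
sumℚ-zipWith-invList a f zero    = refl
sumℚ-zipWith-invList a f (suc m) =
  cong (f 0 *ℚ invSeries a (suc m) +ℚ_) (sumℚ-zipWith-invList a (λ k → f (suc k)) m)

invSeries-suc : ∀ a m → invSeries a (suc m) ≡ - ∑[ k < suc m ] (a (suc k) *ℚ invSeries a (m ∸ k))
invSeries-suc a m = cong -_ (trans
  (cong (λ xs → sumℚ (zipWith _*ℚ_ xs (invList a m))) (List.map-applyUpTo (λ i → i) (λ k → a (suc k)) (suc m)))
  (sumℚ-zipWith-invList a (λ k → a (suc k)) m))

invSeries-unique : ∀ a (T : ℕ → ℚ) → T 0 ≡ 1ℚ →
  (∀ n → T (suc n) ≡ - ∑[ k < suc n ] (a (suc k) *ℚ T (n ∸ k))) →
  ∀ n → T n ≡ invSeries a n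
invSeries-unique a T T0 Tsuc = <-rec (λ n → T n ≡ invSeries a n) step
  where
  step : ∀ n → (∀ {m} → m < n → T m ≡ invSeries a m) → T n ≡ invSeries a n
  step zero    _  = T0
  step (suc n) ih = begin
    T (suc n)                                             ≡⟨ Tsuc n ⟩
    - ∑[ k < suc n ] (a (suc k) *ℚ T (n ∸ k))             ≡⟨ cong -_ (∑-cong (suc n) (λ k _ → cong (a (suc k) *ℚ_) (ih (s≤s (ℕ.m∸n≤m n k))))) ⟩
    - ∑[ k < suc n ] (a (suc k) *ℚ invSeries a (n ∸ k))   ≡⟨ invSeries-suc a n ⟨
    invSeries a (suc n)                                   ∎
    where open ≡-Reasoning

invSeries-cong : ∀ {a a′} → (∀ k → a (suc k) ≡ a′ (suc k)) → ∀ n → invSeries a n ≡ invSeries a′ n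
invSeries-cong {a} {a′} a≗a′ = invSeries-unique a′ (invSeries a) refl λ m →
  trans (invSeries-suc a m) (cong -_ (∑-cong (suc m) (λ k _ → cong (_*ℚ invSeries a (m ∸ k)) (a≗a′ k))))

invSeries-even : ∀ a → (∀ i → a (suc (2 * i)) ≡ 0ℚ) → ∀ n → invSeries a (2 * n) ≡ invSeries (λ k → a (2 * k)) n
invSeries-even a a-odd = invSeries-unique (λ k → a (2 * k)) (λ n → invSeries a (2 * n)) refl recurrence
  where
  recurrence : ∀ n → invSeries a (2 * suc n)
                   ≡ - ∑[ i < suc n ] (a (2 * suc i) *ℚ invSeries a (2 * (n ∸ i)))
  recurrence n = begin
    invSeries a (2 * suc n)                         ≡⟨ cong (invSeries a) (2*suc n) ⟩
    invSeries a (suc (suc (2 * n)))                 ≡⟨ invSeries-suc a (suc (2 * n)) ⟩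
    - ∑ (suc (suc (2 * n))) f                       ≡⟨ cong (λ k → - ∑ k f) (2*suc n) ⟨
    - ∑ (2 * suc n) f                               ≡⟨ cong -_ (∑-evenOdd (suc n) f) ⟩
    - ∑[ i < suc n ] (f (2 * i) +ℚ f (suc (2 * i))) ≡⟨ cong -_ (∑-cong (suc n) (λ i _ → pair i)) ⟩
    - ∑[ i < suc n ] (a (2 * suc i) *ℚ invSeries a (2 * (n ∸ i))) ∎
    where
    open ≡-Reasoning
    f : ℕ → ℚ
    f k = a (suc k) *ℚ invSeries a (suc (2 * n) ∸ k)
    pair : ∀ i → f (2 * i) +ℚ f (suc (2 * i)) ≡ a (2 * suc i) *ℚ invSeries a (2 * (n ∸ i))
    pair i = begin
      f (2 * i) +ℚ f (suc (2 * i))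
        ≡⟨ cong (λ x → x *ℚ invSeries a (suc (2 * n) ∸ 2 * i) +ℚ f (suc (2 * i))) (a-odd i) ⟩
      0ℚ *ℚ invSeries a (suc (2 * n) ∸ 2 * i) +ℚ f (suc (2 * i))
        ≡⟨ cong (_+ℚ f (suc (2 * i))) (ℚ.*-zeroˡ (invSeries a (suc (2 * n) ∸ 2 * i))) ⟩
      0ℚ +ℚ f (suc (2 * i))
        ≡⟨ ℚ.+-identityˡ (f (suc (2 * i))) ⟩
      a (suc (suc (2 * i))) *ℚ invSeries a (2 * n ∸ 2 * i)
        ≡⟨ cong₂ (λ k l → a k *ℚ invSeries a l) (sym (2*suc i)) (sym (ℕ.*-distribˡ-∸ 2 n i)) ⟩
      a (2 * suc i) *ℚ invSeries a (2 * (n ∸ i)) ∎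

isEven-2* : ∀ k → isEven (2 * k) ≡ true
isEven-2* zero    = refl
isEven-2* (suc k) = trans (cong isEven (2*suc k)) (cong (λ b → not (not b)) (isEven-2* k))

coshCoeff-even : ∀ k → coshCoeff (2 * k) ≡ invFact (2 * k)
coshCoeff-even k rewrite isEven-2* k = refl

coshCoeff-odd : ∀ k → coshCoeff (suc (2 * k)) ≡ 0ℚ
coshCoeff-odd k rewrite isEven-2* k = refl

coshSqrtCoeff : ℕ → ℚ
coshSqrtCoeff k = invFact (2 * k)

Euler*invFact : ∀ m → Euler m *ℚ invFact m ≡ invSeries coshCoeff m
Euler*invFact m = begin
  (ℕ→ℚ (m !) *ℚ invSeries coshCoeff m) *ℚ invFact m  ≡⟨ solve 3 (λ A B C → (A :* B) :* C := (A :* C) :* B) refl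
                                                          (ℕ→ℚ (m !)) (invSeries coshCoeff m) (invFact m) ⟩
  (ℕ→ℚ (m !) *ℚ invFact m) *ℚ invSeries coshCoeff m  ≡⟨ cong (_*ℚ invSeries coshCoeff m) (ℕ→ℚ-!*invFact m) ⟩
  1ℚ *ℚ invSeries coshCoeff m                        ≡⟨ ℚ.*-identityˡ (invSeries coshCoeff m) ⟩
  invSeries coshCoeff m                              ∎
  where open ≡-Reasoning

invSeries-cosh-even : ∀ n → invSeries coshCoeff (2 * n) ≡ invSeries coshSqrtCoeff n
invSeries-cosh-even n = trans (invSeries-even coshCoeff coshCoeff-odd n)
  (invSeries-cong (λ k → coshCoeff-even (suc k)) n)

-- Hessenberg determinants

det-cong : ∀ n {M M′ : Fin n → Fin n → ℚ} → (∀ i j → M i j ≡ M′ i j) → det n M ≡ det n M′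
det-cong zero    M≗M′ = refl
det-cong (suc n) M≗M′ = cong (λ v → sumℚ (Vec.toList v)) (Vec.tabulate-cong (λ j →
  cong₂ _*ℚ_ (cong ((- 1ℚ) ^ℚ toℕ j *ℚ_) (M≗M′ fzero j)) (det-cong n (λ i k → M≗M′ (fsuc i) (punchIn j k)))))

sumℚ-tabulate-zero : ∀ n (f : Fin n → ℚ) → (∀ j → f j ≡ 0ℚ) → sumℚ (Vec.toList (Vec.tabulate f)) ≡ 0ℚ
sumℚ-tabulate-zero zero    f f≗0 = refl
sumℚ-tabulate-zero (suc n) f f≗0 =
  cong₂ _+ℚ_ (f≗0 fzero) (sumℚ-tabulate-zero n (λ j → f (fsuc j)) (λ j → f≗0 (fsuc j)))

-- Column 0 is c (i + k) instead of c (i + 1): expanding along the first row only changes k.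
mutual
  hessenberg : (ℕ → ℚ) → ℕ → ℕ → ℕ → ℚ
  hessenberg c k i zero    = c (i + k)
  hessenberg c k i (suc j) = hessenbergUpper c i j

  hessenbergUpper : (ℕ → ℚ) → ℕ → ℕ → ℚ
  hessenbergUpper c zero    zero    = 1ℚ
  hessenbergUpper c zero    (suc j) = 0ℚ
  hessenbergUpper c (suc i) j       = hessenberg c 1 i j

hessenberg-lower : ∀ c i j → j ≤ i → hessenberg c 1 i j ≡ c (i ∸ j + 1)
hessenberg-lower c i       zero    _         = refl
hessenberg-lower c (suc i) (suc j) (s≤s j≤i) = hessenberg-lower c i j j≤i

hessenberg-superdiagonal : ∀ c k i → hessenberg c k i (suc i) ≡ 1ℚ
hessenberg-superdiagonal c k zero    = refl
hessenberg-superdiagonal c k (suc i) = hessenberg-superdiagonal c 1 i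

hessenberg-upper : ∀ c k i j → suc (suc i) ≤ j → hessenberg c k i j ≡ 0ℚ
hessenberg-upper c k zero    (suc zero)    (s≤s ())
hessenberg-upper c k zero    (suc (suc j)) _               = refl
hessenberg-upper c k (suc i) (suc (suc j)) (s≤s (s≤s i<j)) = hessenberg-upper c 1 i (suc j) (s≤s i<j)

hessenbergDet : (ℕ → ℚ) → ℕ → ℕ → ℚ
hessenbergDet c k n = det n (λ i j → hessenberg c k (toℕ i) (toℕ j))

hessenbergDet-expand : ∀ c k n →
  hessenbergDet c k (suc (suc n)) ≡ c k *ℚ hessenbergDet c 1 (suc n) +ℚ (- hessenbergDet c (suc k) (suc n))
hessenbergDet-expand c k n = begin
  F fzero +ℚ (F (fsuc fzero) +ℚ sumℚ (Vec.toList (Vec.tabulate (λ j → F (fsuc (fsuc j))))))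
    ≡⟨ cong₂ (λ u v → F fzero +ℚ (u +ℚ v)) (cong (- 1ℚ *ℚ 1ℚ *ℚ 1ℚ *ℚ_) (det-cong (suc n) minor₁))
                                           (sumℚ-tabulate-zero n _ rest≡0) ⟩
  1ℚ *ℚ c k *ℚ D₁ +ℚ (- 1ℚ *ℚ 1ℚ *ℚ 1ℚ *ℚ Dₖ₊₁ +ℚ 0ℚ)
    ≡⟨ solve 3 (λ x y z → con 1ℚ :* x :* y :+ (:- con 1ℚ :* con 1ℚ :* con 1ℚ :* z :+ con 0ℚ) := x :* y :+ (:- z))
             refl (c k) D₁ Dₖ₊₁ ⟩
  c k *ℚ D₁ +ℚ (- Dₖ₊₁) ∎
  where
  open ≡-Reasoning
  D₁ = hessenbergDet c 1 (suc n)
  Dₖ₊₁ = hessenbergDet c (suc k) (suc n)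
  M : Fin (suc (suc n)) → Fin (suc (suc n)) → ℚ
  M i j = hessenberg c k (toℕ i) (toℕ j)
  F : Fin (suc (suc n)) → ℚ
  F j = (- 1ℚ) ^ℚ toℕ j *ℚ M fzero j *ℚ det (suc n) (λ i l → M (fsuc i) (punchIn j l))
  minor₁ : ∀ i l → M (fsuc i) (punchIn (fsuc fzero) l) ≡ hessenberg c (suc k) (toℕ i) (toℕ l)
  minor₁ i fzero    = cong c (sym (ℕ.+-suc (toℕ i) k))
  minor₁ i (fsuc l) = refl
  rest≡0 : ∀ j → F (fsuc (fsuc j)) ≡ 0ℚ
  rest≡0 j = trans (cong (_*ℚ minor) (ℚ.*-zeroʳ ((- 1ℚ) ^ℚ suc (suc (toℕ j))))) (ℚ.*-zeroˡ minor)
    where minor = det (suc n) (λ i l → M (fsuc i) (punchIn (fsuc (fsuc j)) l))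

module _ (a : ℕ → ℚ) (a₀≡1 : a 0 ≡ 1ℚ) where

  invSeries-convolution : ∀ n → ∑[ j < suc (suc n) ] (a j *ℚ invSeries a (suc n ∸ j)) ≡ 0ℚ
  invSeries-convolution n = begin
    a 0 *ℚ invSeries a (suc n) +ℚ S  ≡⟨ cong (λ x → x *ℚ invSeries a (suc n) +ℚ S) a₀≡1 ⟩
    1ℚ *ℚ invSeries a (suc n) +ℚ S   ≡⟨ cong (_+ℚ S) (trans (ℚ.*-identityˡ _) (invSeries-suc a n)) ⟩
    - S +ℚ S                          ≡⟨ ℚ.+-inverseˡ S ⟩
    0ℚ                                ∎
    where
    open ≡-Reasoning
    S = ∑[ k < suc n ] (a (suc k) *ℚ invSeries a (n ∸ k))

  truncatedProduct : ℕ → ℕ → ℚ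
  truncatedProduct k n = ∑[ j < suc n ] (a j *ℚ invSeries a (k + n ∸ j))

  truncatedProduct-1 : ∀ n → truncatedProduct 1 n ≡ - a (suc n)
  truncatedProduct-1 n = inverseˡ-unique (truncatedProduct 1 n) (a (suc n)) (begin
    truncatedProduct 1 n +ℚ a (suc n)                         ≡⟨ cong (truncatedProduct 1 n +ℚ_) lastTerm ⟨
    truncatedProduct 1 n +ℚ g (suc n)                         ≡⟨ ∑-last (suc n) g ⟨
    ∑ (suc (suc n)) g                                         ≡⟨ invSeries-convolution n ⟩
    0ℚ                                                        ∎)
    where
    open ≡-Reasoning
    g : ℕ → ℚ
    g j = a j *ℚ invSeries a (suc n ∸ j)
    lastTerm : g (suc n) ≡ a (suc n)
    lastTerm = trans (cong (λ k → a (suc n) *ℚ invSeries a k) (ℕ.n∸n≡0 n)) (ℚ.*-identityʳ (a (suc n)))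

  truncatedProduct-suc : ∀ k n →
    truncatedProduct k (suc n) ≡ truncatedProduct (suc k) n +ℚ a (suc n) *ℚ invSeries a k
  truncatedProduct-suc k n = trans (∑-last (suc n) (λ j → a j *ℚ invSeries a (k + suc n ∸ j)))
    (cong₂ _+ℚ_ (∑-cong (suc n) (λ j _ → cong (λ m → a j *ℚ invSeries a (m ∸ j)) (ℕ.+-suc k n)))
                (cong (λ m → a (suc n) *ℚ invSeries a m) (ℕ.m+n∸n≡m k (suc n))))

  hessenbergDet-invSeries : ∀ n k →
    hessenbergDet (invSeries a) k (suc n) ≡ (- 1ℚ) ^ℚ n *ℚ truncatedProduct k n
  hessenbergDet-invSeries zero    k = begin
    1ℚ *ℚ c k *ℚ 1ℚ +ℚ 0ℚ            ≡⟨ solve 1 (λ x → con 1ℚ :* x :* con 1ℚ :+ con 0ℚ := con 1ℚ :* (con 1ℚ :* x :+ con 0ℚ))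
                                               refl (c k) ⟩
    1ℚ *ℚ (1ℚ *ℚ c k +ℚ 0ℚ)          ≡⟨ cong₂ (λ x m → 1ℚ *ℚ (x *ℚ c m +ℚ 0ℚ)) (sym a₀≡1) (sym (ℕ.+-identityʳ k)) ⟩
    1ℚ *ℚ (a 0 *ℚ c (k + 0) +ℚ 0ℚ)   ∎
    where
    open ≡-Reasoning
    c = invSeries a
  hessenbergDet-invSeries (suc n) k = begin
    hessenbergDet c k (suc (suc n))
      ≡⟨ hessenbergDet-expand c k n ⟩
    c k *ℚ hessenbergDet c 1 (suc n) +ℚ (- hessenbergDet c (suc k) (suc n))
      ≡⟨ cong₂ (λ u v → c k *ℚ u +ℚ (- v))
               (trans (hessenbergDet-invSeries n 1) (cong (σ *ℚ_) (truncatedProduct-1 n)))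
               (hessenbergDet-invSeries n (suc k)) ⟩
    c k *ℚ (σ *ℚ (- a (suc n))) +ℚ (- (σ *ℚ truncatedProduct (suc k) n))
      ≡⟨ solve 4 (λ C s x p → C :* (s :* (:- x)) :+ (:- (s :* p)) := (:- con 1ℚ :* s) :* (p :+ x :* C))
               refl (c k) σ (a (suc n)) (truncatedProduct (suc k) n) ⟩
    (- 1ℚ) ^ℚ suc n *ℚ (truncatedProduct (suc k) n +ℚ a (suc n) *ℚ c k)
      ≡⟨ cong ((- 1ℚ) ^ℚ suc n *ℚ_) (truncatedProduct-suc k n) ⟨
    (- 1ℚ) ^ℚ suc n *ℚ truncatedProduct k (suc n) ∎
    where
    open ≡-Reasoning
    c = invSeries a
    σ = (- 1ℚ) ^ℚ n

  hessenbergDet-invSeries-1 : ∀ n → hessenbergDet (invSeries a) 1 (suc n) ≡ (- 1ℚ) ^ℚ suc n *ℚ a (suc n)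
  hessenbergDet-invSeries-1 n = begin
    hessenbergDet (invSeries a) 1 (suc n)   ≡⟨ hessenbergDet-invSeries n 1 ⟩
    σ *ℚ truncatedProduct 1 n               ≡⟨ cong (σ *ℚ_) (truncatedProduct-1 n) ⟩
    σ *ℚ (- a (suc n))                      ≡⟨ solve 2 (λ s x → s :* (:- x) := (:- con 1ℚ :* s) :* x) refl σ (a (suc n)) ⟩
    (- 1ℚ) ^ℚ suc n *ℚ a (suc n)            ∎
    where
    open ≡-Reasoning
    σ = (- 1ℚ) ^ℚ n

-- Sums over partitions

n≤m⇒m<n+o⇒m∸n<o : ∀ {m n o} → n ≤ m → m < n + o → m ∸ n < o
n≤m⇒m<n+o⇒m∸n<o {n = zero}  _         m<o     = m<o
n≤m⇒m<n+o⇒m∸n<o {n = suc n} (s≤s n≤m) (s≤s m<n+o) = n≤m⇒m<n+o⇒m∸n<o n≤m m<n+o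

module TupleSum (a : ℕ → ℚ) where

  expCoeff : ℕ → ℕ → ℚ
  expCoeff s x = (- 1ℚ) ^ℚ x *ℚ (a s ^ℚ x *ℚ invFact x)

  expCoeff-suc : ∀ s y → expCoeff s (suc y) *ℚ ℕ→ℚ (suc y) ≡ - a s *ℚ expCoeff s y
  expCoeff-suc s y = begin
    (- 1ℚ *ℚ σ) *ℚ ((a s *ℚ p) *ℚ invFact (suc y)) *ℚ ℕ→ℚ (suc y)
      ≡⟨ solve 5 (λ σ x p i n → ((:- con 1ℚ) :* σ) :* ((x :* p) :* i) :* n := (:- x) :* (σ :* (p :* (n :* i))))
               refl σ (a s) p (invFact (suc y)) (ℕ→ℚ (suc y)) ⟩
    - a s *ℚ (σ *ℚ (p *ℚ (ℕ→ℚ (suc y) *ℚ invFact (suc y))))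
      ≡⟨ cong (λ z → - a s *ℚ (σ *ℚ (p *ℚ z))) (ℕ→ℚ-suc*invFact-suc y) ⟩
    - a s *ℚ (σ *ℚ (p *ℚ invFact y)) ∎
    where
    open ≡-Reasoning
    σ = (- 1ℚ) ^ℚ y
    p = a s ^ℚ y

  -- tupleSum bnd m k s e u sums, over t ∈ {0,…,bnd}ᵏ with e + Σⱼ (s + j) tⱼ = m,
  -- the terms (u + Σⱼ tⱼ)! Πⱼ (- a (s + j))^tⱼ / tⱼ!  (see sumℚ-tupleWeight).
  tupleSum : (bnd m k s e u : ℕ) → ℚ
  tupleSum bnd m zero    s e u = 𝟙 (e ≟ m) *ℚ ℕ→ℚ (u !)
  tupleSum bnd m (suc k) s e u = ∑[ x < suc bnd ] (expCoeff s x *ℚ tupleSum bnd m k (suc s) (e + s * x) (u + x))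

  tupleSum-overweight : ∀ bnd m k s e u → m < e → tupleSum bnd m k s e u ≡ 0ℚ
  tupleSum-overweight bnd m zero    s e u m<e =
    trans (cong (_*ℚ ℕ→ℚ (u !)) (𝟙-no (e ≟ m) (λ e≡m → ℕ.<-irrefl (sym e≡m) m<e))) (ℚ.*-zeroˡ (ℕ→ℚ (u !)))
  tupleSum-overweight bnd m (suc k) s e u m<e = ∑-zero (suc bnd) (λ x _ →
    trans (cong (expCoeff s x *ℚ_) (tupleSum-overweight bnd m k (suc s) (e + s * x) (u + x)
                                      (ℕ.<-≤-trans m<e (ℕ.m≤m+n e (s * x)))))
          (ℚ.*-zeroʳ (expCoeff s x)))

  m<e+s+s*bnd : ∀ e s bnd m → 1 ≤ s → m ≤ bnd → m < (e + s) + s * bnd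
  m<e+s+s*bnd e (suc s) bnd m _ m≤bnd = begin-strict
    m                               ≤⟨ m≤bnd ⟩
    bnd                             ≤⟨ ℕ.m≤n*m bnd (suc s) ⟩
    suc s * bnd                     <⟨ ℕ.m<n+m (suc s * bnd) {suc s} (s≤s z≤n) ⟩
    suc s + suc s * bnd             ≤⟨ ℕ.m≤n+m _ e ⟩
    e + (suc s + suc s * bnd)       ≡⟨ ℕ.+-assoc e (suc s) (suc s * bnd) ⟨
    (e + suc s) + suc s * bnd       ∎
    where open ℕ.≤-Reasoning

  -- Writing (u + Σ t)! = u (u - 1 + Σ t)! + Σⱼ tⱼ (u - 1 + Σ t)! and absorbing tⱼ into
  -- (- aⱼ)^tⱼ / tⱼ! = - aⱼ (- aⱼ)^(tⱼ - 1) / (tⱼ - 1)! lowers tⱼ by one; the entry that would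
  -- be lost at the bound bnd has weight above m.
  module Recurrence (bnd m : ℕ) (m≤bnd : m ≤ bnd) where

    offsetTerm : (k s e u : ℕ) → ℚ
    offsetTerm k s e zero    = 𝟙 (e ≟ m)
    offsetTerm k s e (suc u) = ℕ→ℚ (suc u) *ℚ tupleSum bnd m k s e u

    loweringTerm : (k s e u : ℕ) → ℚ
    loweringTerm k s e u = ∑[ j < k ] (a (s + j) *ℚ tupleSum bnd m k s (e + (s + j)) u)

    ∑-lowerFirst : ∀ k s e w → 1 ≤ s →
      ∑[ y < bnd ] ((expCoeff s (suc y) *ℚ ℕ→ℚ (suc y)) *ℚ tupleSum bnd m k (suc s) (e + s * suc y) (w + y))
      ≡ - (a s *ℚ tupleSum bnd m (suc k) s (e + s) w)
    ∑-lowerFirst k s e w 1≤s = begin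
      ∑[ y < bnd ] ((expCoeff s (suc y) *ℚ ℕ→ℚ (suc y)) *ℚ tupleSum bnd m k (suc s) (e + s * suc y) (w + y))
        ≡⟨ ∑-cong bnd (λ y _ → trans (cong₂ (λ u v → u *ℚ tupleSum bnd m k (suc s) v (w + y))
                                            (expCoeff-suc s y) (e+s*suc[y] y))
                                     (ℚ.*-assoc (- a s) (expCoeff s y) _)) ⟩
      ∑[ y < bnd ] (- a s *ℚ g y)               ≡⟨ *-distribˡ-∑ bnd (- a s) g ⟨
      - a s *ℚ ∑ bnd g                          ≡⟨ solve 2 (λ x G → (:- x) :* G := :- (x :* (G :+ con 0ℚ))) refl (a s) (∑ bnd g) ⟩
      - (a s *ℚ (∑ bnd g +ℚ 0ℚ))               ≡⟨ cong (λ z → - (a s *ℚ (∑ bnd g +ℚ z))) g-bnd≡0 ⟨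
      - (a s *ℚ (∑ bnd g +ℚ g bnd))            ≡⟨ cong (λ z → - (a s *ℚ z)) (∑-last bnd g) ⟨
      - (a s *ℚ tupleSum bnd m (suc k) s (e + s) w) ∎
      where
      open ≡-Reasoning
      e+s*suc[y] : ∀ y → e + s * suc y ≡ (e + s) + s * y
      e+s*suc[y] = ℕS.solve 3 (λ e s y → e ℕS.:+ s ℕS.:* (ℕS.con 1 ℕS.:+ y) ℕS.:= (e ℕS.:+ s) ℕS.:+ s ℕS.:* y) refl e s
      g : ℕ → ℚ
      g y = expCoeff s y *ℚ tupleSum bnd m k (suc s) ((e + s) + s * y) (w + y)
      g-bnd≡0 : g bnd ≡ 0ℚ
      g-bnd≡0 = trans (cong (expCoeff s bnd *ℚ_)
                        (tupleSum-overweight bnd m k (suc s) ((e + s) + s * bnd) (w + bnd) (m<e+s+s*bnd e s bnd m 1≤s m≤bnd)))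
                      (ℚ.*-zeroʳ (expCoeff s bnd))

    ∑-expCoeff*offsetTerm : ∀ k s e u → 1 ≤ s →
      ∑[ x < suc bnd ] (expCoeff s x *ℚ offsetTerm k (suc s) (e + s * x) (u + x))
      ≡ offsetTerm (suc k) s e u +ℚ (- (a s *ℚ tupleSum bnd m (suc k) s (e + s) u))
    ∑-expCoeff*offsetTerm k s e zero 1≤s = cong₂ _+ℚ_
      (trans (ℚ.*-identityˡ _) (cong (λ z → 𝟙 (z ≟ m)) (trans (cong (e +_) (ℕ.*-zeroʳ s)) (ℕ.+-identityʳ e))))
      (trans (∑-cong bnd (λ y _ → sym (ℚ.*-assoc (expCoeff s (suc y)) (ℕ→ℚ (suc y)) _)))
             (∑-lowerFirst k s e 0 1≤s))
    ∑-expCoeff*offsetTerm k s e (suc u) 1≤s = begin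
      ∑[ x < suc bnd ] (expCoeff s x *ℚ (ℕ→ℚ (suc (u + x)) *ℚ V x))
        ≡⟨ ∑-cong (suc bnd) (λ x _ → trans (cong (λ z → expCoeff s x *ℚ (z *ℚ V x)) (ℕ→ℚ-+ (suc u) x))
             (solve 4 (λ C U X W → C :* ((U :+ X) :* W) := U :* (C :* W) :+ (C :* X) :* W)
                    refl (expCoeff s x) (ℕ→ℚ (suc u)) (ℕ→ℚ x) (V x))) ⟩
      ∑[ x < suc bnd ] (ℕ→ℚ (suc u) *ℚ (expCoeff s x *ℚ V x) +ℚ (expCoeff s x *ℚ ℕ→ℚ x) *ℚ V x)
        ≡⟨ ∑-distrib-+ (suc bnd) (λ x → ℕ→ℚ (suc u) *ℚ (expCoeff s x *ℚ V x)) (λ x → (expCoeff s x *ℚ ℕ→ℚ x) *ℚ V x) ⟩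
      ∑[ x < suc bnd ] (ℕ→ℚ (suc u) *ℚ (expCoeff s x *ℚ V x)) +ℚ ∑[ x < suc bnd ] ((expCoeff s x *ℚ ℕ→ℚ x) *ℚ V x)
        ≡⟨ cong₂ _+ℚ_ (sym (*-distribˡ-∑ (suc bnd) (ℕ→ℚ (suc u)) (λ x → expCoeff s x *ℚ V x))) lowered ⟩
      offsetTerm (suc k) s e (suc u) +ℚ (- (a s *ℚ tupleSum bnd m (suc k) s (e + s) (suc u))) ∎
      where
      open ≡-Reasoning
      V : ℕ → ℚ
      V x = tupleSum bnd m k (suc s) (e + s * x) (u + x)
      L = ∑[ y < bnd ] ((expCoeff s (suc y) *ℚ ℕ→ℚ (suc y)) *ℚ V (suc y))
      lowered : ∑[ x < suc bnd ] ((expCoeff s x *ℚ ℕ→ℚ x) *ℚ V x) ≡ - (a s *ℚ tupleSum bnd m (suc k) s (e + s) (suc u))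
      lowered = begin
        (expCoeff s 0 *ℚ 0ℚ) *ℚ V 0 +ℚ ∑[ y < bnd ] ((expCoeff s (suc y) *ℚ ℕ→ℚ (suc y)) *ℚ V (suc y))
          ≡⟨ cong (_+ℚ L) (trans (cong (_*ℚ V 0) (ℚ.*-zeroʳ (expCoeff s 0))) (ℚ.*-zeroˡ (V 0))) ⟩
        0ℚ +ℚ L
          ≡⟨ ℚ.+-identityˡ L ⟩
        ∑[ y < bnd ] ((expCoeff s (suc y) *ℚ ℕ→ℚ (suc y)) *ℚ V (suc y))
          ≡⟨ ∑-cong bnd (λ y _ → cong (λ z → (expCoeff s (suc y) *ℚ ℕ→ℚ (suc y)) *ℚ tupleSum bnd m k (suc s) (e + s * suc y) z)
                                      (ℕ.+-suc u y)) ⟩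
        ∑[ y < bnd ] ((expCoeff s (suc y) *ℚ ℕ→ℚ (suc y)) *ℚ tupleSum bnd m k (suc s) (e + s * suc y) (suc u + y))
          ≡⟨ ∑-lowerFirst k s e (suc u) 1≤s ⟩
        - (a s *ℚ tupleSum bnd m (suc k) s (e + s) (suc u)) ∎

    ∑-expCoeff*loweringTerm : ∀ k s e u →
      ∑[ x < suc bnd ] (expCoeff s x *ℚ loweringTerm k (suc s) (e + s * x) (u + x))
      ≡ ∑[ j < k ] (a (s + suc j) *ℚ tupleSum bnd m (suc k) s (e + (s + suc j)) u)
    ∑-expCoeff*loweringTerm k s e u = begin
      ∑[ x < suc bnd ] (expCoeff s x *ℚ ∑[ j < k ] f x j)
        ≡⟨ ∑-cong (suc bnd) (λ x _ → *-distribˡ-∑ k (expCoeff s x) (f x)) ⟩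
      ∑[ x < suc bnd ] ∑[ j < k ] (expCoeff s x *ℚ f x j)
        ≡⟨ ∑-comm (suc bnd) k (λ x j → expCoeff s x *ℚ f x j) ⟩
      ∑[ j < k ] ∑[ x < suc bnd ] (expCoeff s x *ℚ f x j)
        ≡⟨ ∑-cong k (λ j _ → trans (∑-cong (suc bnd) (λ x _ → reorder x j))
                                   (sym (*-distribˡ-∑ (suc bnd) (a (s + suc j)) (λ x → expCoeff s x *ℚ V j x)))) ⟩
      ∑[ j < k ] (a (s + suc j) *ℚ tupleSum bnd m (suc k) s (e + (s + suc j)) u) ∎
      where
      open ≡-Reasoning
      f : ℕ → ℕ → ℚ
      f x j = a (suc s + j) *ℚ tupleSum bnd m k (suc s) ((e + s * x) + (suc s + j)) (u + x)
      V : ℕ → ℕ → ℚ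
      V j x = tupleSum bnd m k (suc s) ((e + (s + suc j)) + s * x) (u + x)
      weight : ∀ x j → (e + s * x) + (suc s + j) ≡ (e + (s + suc j)) + s * x
      weight x j = ℕS.solve 4 (λ e s x j → (e ℕS.:+ s ℕS.:* x) ℕS.:+ ((ℕS.con 1 ℕS.:+ s) ℕS.:+ j)
                                          ℕS.:= (e ℕS.:+ (s ℕS.:+ (ℕS.con 1 ℕS.:+ j))) ℕS.:+ s ℕS.:* x) refl e s x j
      reorder : ∀ x j → expCoeff s x *ℚ f x j ≡ a (s + suc j) *ℚ (expCoeff s x *ℚ V j x)
      reorder x j = begin
        expCoeff s x *ℚ f x j
          ≡⟨ cong₂ (λ i w → expCoeff s x *ℚ (a i *ℚ tupleSum bnd m k (suc s) w (u + x))) (sym (ℕ.+-suc s j)) (weight x j) ⟩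
        expCoeff s x *ℚ (a (s + suc j) *ℚ V j x)
          ≡⟨ solve 3 (λ C X W → C :* (X :* W) := X :* (C :* W)) refl (expCoeff s x) (a (s + suc j)) (V j x) ⟩
        a (s + suc j) *ℚ (expCoeff s x *ℚ V j x) ∎

    tupleSum-recurrence : ∀ k s e u → 1 ≤ s → tupleSum bnd m k s e u ≡ offsetTerm k s e u +ℚ (- loweringTerm k s e u)
    tupleSum-recurrence zero s e zero    _ = trans (ℚ.*-identityʳ (𝟙 (e ≟ m))) (sym (ℚ.+-identityʳ (𝟙 (e ≟ m))))
    tupleSum-recurrence zero s e (suc u) _ = trans (cong (𝟙 (e ≟ m) *ℚ_) (ℕ→ℚ-* (suc u) (u !)))
      (solve 3 (λ I A B → I :* (A :* B) := A :* (I :* B) :+ (:- con 0ℚ)) refl (𝟙 (e ≟ m)) (ℕ→ℚ (suc u)) (ℕ→ℚ (u !)))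
    tupleSum-recurrence (suc k) s e u 1≤s = begin
      ∑[ x < suc bnd ] (expCoeff s x *ℚ tupleSum bnd m k (suc s) (e + s * x) (u + x))
        ≡⟨ ∑-cong (suc bnd) (λ x _ → trans (cong (expCoeff s x *ℚ_) (tupleSum-recurrence k (suc s) (e + s * x) (u + x) (s≤s z≤n)))
                                          (split x)) ⟩
      ∑[ x < suc bnd ] (expCoeff s x *ℚ O x +ℚ (- (expCoeff s x *ℚ L x)))
        ≡⟨ ∑-distrib-+ (suc bnd) (λ x → expCoeff s x *ℚ O x) (λ x → - (expCoeff s x *ℚ L x)) ⟩
      ∑[ x < suc bnd ] (expCoeff s x *ℚ O x) +ℚ ∑[ x < suc bnd ] (- (expCoeff s x *ℚ L x))
        ≡⟨ cong (∑[ x < suc bnd ] (expCoeff s x *ℚ O x) +ℚ_) (neg-distrib-∑ (suc bnd) (λ x → expCoeff s x *ℚ L x)) ⟨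
      ∑[ x < suc bnd ] (expCoeff s x *ℚ O x) +ℚ (- ∑[ x < suc bnd ] (expCoeff s x *ℚ L x))
        ≡⟨ cong₂ (λ p q → p +ℚ (- q)) (∑-expCoeff*offsetTerm k s e u 1≤s) (∑-expCoeff*loweringTerm k s e u) ⟩
      (offsetTerm (suc k) s e u +ℚ (- (a s *ℚ tupleSum bnd m (suc k) s (e + s) u))) +ℚ (- rest)
        ≡⟨ cong (λ i → (offsetTerm (suc k) s e u +ℚ (- (a i *ℚ tupleSum bnd m (suc k) s (e + i) u))) +ℚ (- rest))
                (sym (ℕ.+-identityʳ s)) ⟩
      (offsetTerm (suc k) s e u +ℚ (- first)) +ℚ (- rest)
        ≡⟨ solve 3 (λ z x r → (z :+ (:- x)) :+ (:- r) := z :+ (:- (x :+ r))) refl (offsetTerm (suc k) s e u) first rest ⟩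
      offsetTerm (suc k) s e u +ℚ (- loweringTerm (suc k) s e u) ∎
      where
      open ≡-Reasoning
      O L : ℕ → ℚ
      O x = offsetTerm k (suc s) (e + s * x) (u + x)
      L x = loweringTerm k (suc s) (e + s * x) (u + x)
      split : ∀ x → expCoeff s x *ℚ (O x +ℚ (- L x)) ≡ expCoeff s x *ℚ O x +ℚ (- (expCoeff s x *ℚ L x))
      split x = trans (ℚ.*-distribˡ-+ (expCoeff s x) (O x) (- L x))
                      (cong (expCoeff s x *ℚ O x +ℚ_) (sym (ℚ.neg-distribʳ-* (expCoeff s x) (L x))))
      first = a (s + 0) *ℚ tupleSum bnd m (suc k) s (e + (s + 0)) u
      rest = ∑[ j < k ] (a (s + suc j) *ℚ tupleSum bnd m (suc k) s (e + (s + suc j)) u)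

  tupleSum-shift : ∀ bnd m k s e u → e ≤ m → tupleSum bnd m k s e u ≡ tupleSum bnd (m ∸ e) k s 0 u
  tupleSum-shift bnd m zero s e u e≤m = cong (_*ℚ ℕ→ℚ (u !)) (𝟙-⇔ (e ≟ m) (0 ≟ m ∸ e)
    (λ e≡m → sym (trans (cong (_∸ e) (sym e≡m)) (ℕ.n∸n≡0 e)))
    (λ 0≡m∸e → trans (sym (ℕ.+-identityʳ e)) (trans (cong (e +_) 0≡m∸e) (ℕ.m+[n∸m]≡n e≤m))))
  tupleSum-shift bnd m (suc k) s e u e≤m = ∑-cong (suc bnd) (λ x _ → cong (expCoeff s x *ℚ_) (term x))
    where
    term : ∀ x → tupleSum bnd m k (suc s) (e + s * x) (u + x) ≡ tupleSum bnd (m ∸ e) k (suc s) (s * x) (u + x)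
    term x with (e + s * x) ≤? m
    ... | yes e+sx≤m = begin
      tupleSum bnd m k (suc s) (e + s * x) (u + x)
        ≡⟨ tupleSum-shift bnd m k (suc s) (e + s * x) (u + x) e+sx≤m ⟩
      tupleSum bnd (m ∸ (e + s * x)) k (suc s) 0 (u + x)
        ≡⟨ cong (λ z → tupleSum bnd z k (suc s) 0 (u + x)) (ℕ.∸-+-assoc m e (s * x)) ⟨
      tupleSum bnd (m ∸ e ∸ s * x) k (suc s) 0 (u + x)
        ≡⟨ tupleSum-shift bnd (m ∸ e) k (suc s) (s * x) (u + x) (ℕ.m+n≤o⇒m≤o∸n (s * x) (subst (_≤ m) (ℕ.+-comm e (s * x)) e+sx≤m)) ⟨
      tupleSum bnd (m ∸ e) k (suc s) (s * x) (u + x) ∎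
      where open ≡-Reasoning
    ... | no e+sx≰m = trans (tupleSum-overweight bnd m k (suc s) (e + s * x) (u + x) (ℕ.≰⇒> e+sx≰m))
      (sym (tupleSum-overweight bnd (m ∸ e) k (suc s) (s * x) (u + x) (n≤m⇒m<n+o⇒m∸n<o e≤m (ℕ.≰⇒> e+sx≰m))))

  tupleSum-bound : ∀ bnd m k s e u → 1 ≤ s → m ≤ bnd → tupleSum bnd m k s e u ≡ tupleSum m m k s e u
  tupleSum-bound bnd m zero    s e u 1≤s m≤bnd = refl
  tupleSum-bound bnd m (suc k) s e u 1≤s m≤bnd with ℕ.m≤n⇒∃[o]m+o≡n m≤bnd
  ... | d , refl = begin
    ∑ (suc m + d) f                                   ≡⟨ ∑-+ (suc m) d f ⟩
    ∑ (suc m) f +ℚ ∑[ i < d ] f (suc m + i)          ≡⟨ cong (∑ (suc m) f +ℚ_) (∑-zero d (λ i _ → beyond (suc m + i) (s≤s (ℕ.m≤m+n m i)))) ⟩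
    ∑ (suc m) f +ℚ 0ℚ                                 ≡⟨ ℚ.+-identityʳ (∑ (suc m) f) ⟩
    ∑ (suc m) f                                       ≡⟨ ∑-cong (suc m) (λ x _ → cong (expCoeff s x *ℚ_)
                                                           (tupleSum-bound (m + d) m k (suc s) (e + s * x) (u + x) (s≤s z≤n) m≤bnd)) ⟩
    tupleSum m m (suc k) s e u                        ∎
    where
    open ≡-Reasoning
    f : ℕ → ℚ
    f x = expCoeff s x *ℚ tupleSum (m + d) m k (suc s) (e + s * x) (u + x)
    beyond : ∀ x → m < x → f x ≡ 0ℚ
    beyond x m<x = trans (cong (expCoeff s x *ℚ_) (tupleSum-overweight (m + d) m k (suc s) (e + s * x) (u + x)
                           (ℕ.<-≤-trans m<x (ℕ.≤-trans (ℕ.m≤n*m x s {{>-nonZero 1≤s}}) (ℕ.m≤n+m (s * x) e)))))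
                         (ℚ.*-zeroʳ (expCoeff s x))

  tupleSum-suc-length : ∀ bnd m k s e u → m < s + k → tupleSum bnd m (suc k) s e u ≡ tupleSum bnd m k s e u
  tupleSum-suc-length bnd m zero s e u m<s+0 = trans (cong₂ _+ℚ_ first rest) (ℚ.+-identityʳ _)
    where
    first : expCoeff s 0 *ℚ (𝟙 (e + s * 0 ≟ m) *ℚ ℕ→ℚ ((u + 0) !)) ≡ 𝟙 (e ≟ m) *ℚ ℕ→ℚ (u !)
    first = trans (ℚ.*-identityˡ _) (cong₂ (λ w v → 𝟙 (w ≟ m) *ℚ ℕ→ℚ (v !))
                                           (trans (cong (e +_) (ℕ.*-zeroʳ s)) (ℕ.+-identityʳ e)) (ℕ.+-identityʳ u))
    rest : ∑[ y < bnd ] (expCoeff s (suc y) *ℚ tupleSum bnd m 0 (suc s) (e + s * suc y) (u + suc y)) ≡ 0ℚ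
    rest = ∑-zero bnd (λ y _ → trans (cong (expCoeff s (suc y) *ℚ_)
      (tupleSum-overweight bnd m 0 (suc s) (e + s * suc y) (u + suc y)
        (ℕ.<-≤-trans (subst (m <_) (ℕ.+-identityʳ s) m<s+0) (ℕ.≤-trans (ℕ.m≤m*n s (suc y)) (ℕ.m≤n+m (s * suc y) e)))))
      (ℚ.*-zeroʳ (expCoeff s (suc y))))
  tupleSum-suc-length bnd m (suc k) s e u m<s+k = ∑-cong (suc bnd) (λ x _ → cong (expCoeff s x *ℚ_)
    (tupleSum-suc-length bnd m k (suc s) (e + s * x) (u + x) (subst (m <_) (ℕ.+-suc s k) m<s+k)))

  tupleSum-+-length : ∀ bnd m k d e u → m ≤ k → tupleSum bnd m (k + d) 1 e u ≡ tupleSum bnd m k 1 e u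
  tupleSum-+-length bnd m k zero    e u m≤k = cong (λ l → tupleSum bnd m l 1 e u) (ℕ.+-identityʳ k)
  tupleSum-+-length bnd m k (suc d) e u m≤k = begin
    tupleSum bnd m (k + suc d) 1 e u    ≡⟨ cong (λ l → tupleSum bnd m l 1 e u) (ℕ.+-suc k d) ⟩
    tupleSum bnd m (suc (k + d)) 1 e u  ≡⟨ tupleSum-suc-length bnd m (k + d) 1 e u (s≤s (ℕ.≤-trans m≤k (ℕ.m≤m+n k d))) ⟩
    tupleSum bnd m (k + d) 1 e u        ≡⟨ tupleSum-+-length bnd m k d e u m≤k ⟩
    tupleSum bnd m k 1 e u              ∎
    where open ≡-Reasoning

  expProduct : ℕ → ∀ {k} → Vec ℕ k → ℚ
  expProduct s []      = 1ℚ
  expProduct s (x ∷ t) = (a s ^ℚ x *ℚ invFact x) *ℚ expProduct (suc s) t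

  tupleWeight : (m s e u : ℕ) → ∀ {k} → Vec ℕ k → ℚ
  tupleWeight m s e u t =
    𝟙 (e + wsum s t ≟ m) *ℚ (ℕ→ℚ ((Vec.sum t + u) !) *ℚ ((- 1ℚ) ^ℚ Vec.sum t *ℚ expProduct s t))

  tupleWeight-∷ : ∀ m s e u x {k} (t : Vec ℕ k) →
    tupleWeight m s e u (x ∷ t) ≡ expCoeff s x *ℚ tupleWeight m (suc s) (e + s * x) (u + x) t
  tupleWeight-∷ m s e u x t = begin
    𝟙 (e + (s * x + w) ≟ m) *ℚ (ℕ→ℚ ((x + N + u) !) *ℚ ((- 1ℚ) ^ℚ (x + N) *ℚ (((a s ^ℚ x) *ℚ invFact x) *ℚ P)))
      ≡⟨ cong₂ (λ p q → 𝟙 (p ≟ m) *ℚ (ℕ→ℚ (q !) *ℚ ((- 1ℚ) ^ℚ (x + N) *ℚ (((a s ^ℚ x) *ℚ invFact x) *ℚ P))))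
               (sym (ℕ.+-assoc e (s * x) w))
               (ℕS.solve 3 (λ x N u → x ℕS.:+ N ℕS.:+ u ℕS.:= N ℕS.:+ (u ℕS.:+ x)) refl x N u) ⟩
    I *ℚ (F *ℚ ((- 1ℚ) ^ℚ (x + N) *ℚ ((A *ℚ J) *ℚ P)))
      ≡⟨ cong (λ z → I *ℚ (F *ℚ (z *ℚ ((A *ℚ J) *ℚ P)))) (^ℚ-+ (- 1ℚ) x N) ⟩
    I *ℚ (F *ℚ (((- 1ℚ) ^ℚ x *ℚ (- 1ℚ) ^ℚ N) *ℚ ((A *ℚ J) *ℚ P)))
      ≡⟨ solve 7 (λ I F σ τ A J P → I :* (F :* ((σ :* τ) :* ((A :* J) :* P))) := (σ :* (A :* J)) :* (I :* (F :* (τ :* P))))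
               refl I F ((- 1ℚ) ^ℚ x) ((- 1ℚ) ^ℚ N) A J P ⟩
    expCoeff s x *ℚ tupleWeight m (suc s) (e + s * x) (u + x) t ∎
    where
    open ≡-Reasoning
    N = Vec.sum t
    w = wsum (suc s) t
    I = 𝟙 ((e + s * x) + w ≟ m)
    F = ℕ→ℚ ((N + (u + x)) !)
    A = a s ^ℚ x
    J = invFact x
    P = expProduct (suc s) t

  sumℚ-tupleWeight : ∀ bnd m k s e u → sumℚ (map (tupleWeight m s e u) (allVecs bnd k)) ≡ tupleSum bnd m k s e u
  sumℚ-tupleWeight bnd m zero    s e u = trans (ℚ.+-identityʳ _)
    (cong₂ _*ℚ_ (cong (λ z → 𝟙 (z ≟ m)) (ℕ.+-identityʳ e)) (ℚ.*-identityʳ (ℕ→ℚ (u !))))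
  sumℚ-tupleWeight bnd m (suc k) s e u = begin
    sumℚ (map w (concatMap extend (upTo (suc bnd))))
      ≡⟨ sumℚ-map-concatMap extend w (upTo (suc bnd)) ⟩
    sumℚ (map (λ x → sumℚ (map w (extend x))) (upTo (suc bnd)))
      ≡⟨ sumℚ-map-upTo (suc bnd) (λ x → sumℚ (map w (extend x))) ⟩
    ∑[ x < suc bnd ] sumℚ (map w (extend x))
      ≡⟨ ∑-cong (suc bnd) (λ x _ → column x) ⟩
    tupleSum bnd m (suc k) s e u ∎
    where
    open ≡-Reasoning
    w = tupleWeight m s e u
    extend : ℕ → List (Vec ℕ (suc k))
    extend x = map (x ∷_) (allVecs bnd k)
    column : ∀ x → sumℚ (map w (extend x)) ≡ expCoeff s x *ℚ tupleSum bnd m k (suc s) (e + s * x) (u + x)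
    column x = begin
      sumℚ (map w (map (x ∷_) (allVecs bnd k)))
        ≡⟨ cong sumℚ (List.map-∘ (allVecs bnd k)) ⟨
      sumℚ (map (λ t → w (x ∷ t)) (allVecs bnd k))
        ≡⟨ cong sumℚ (List.map-cong (tupleWeight-∷ m s e u x) (allVecs bnd k)) ⟩
      sumℚ (map (λ t → expCoeff s x *ℚ tupleWeight m (suc s) (e + s * x) (u + x) t) (allVecs bnd k))
        ≡⟨ *-distribˡ-sumℚ-map (expCoeff s x) (tupleWeight m (suc s) (e + s * x) (u + x)) (allVecs bnd k) ⟨
      expCoeff s x *ℚ sumℚ (map (tupleWeight m (suc s) (e + s * x) (u + x)) (allVecs bnd k))
        ≡⟨ cong (expCoeff s x *ℚ_) (sumℚ-tupleWeight bnd m k (suc s) (e + s * x) (u + x)) ⟩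
      expCoeff s x *ℚ tupleSum bnd m k (suc s) (e + s * x) (u + x) ∎

  partitionSum : ℕ → ℚ
  partitionSum n = tupleSum n n n 1 0 0

  partitionSum-lowered : ∀ n j → j ≤ n → tupleSum (suc n) (suc n) (suc n) 1 (suc j) 0 ≡ partitionSum (n ∸ j)
  partitionSum-lowered n j j≤n = begin
    tupleSum (suc n) (suc n) (suc n) 1 (suc j) 0    ≡⟨ tupleSum-shift (suc n) (suc n) (suc n) 1 (suc j) 0 (s≤s j≤n) ⟩
    tupleSum (suc n) (n ∸ j) (suc n) 1 0 0          ≡⟨ tupleSum-bound (suc n) (n ∸ j) (suc n) 1 0 0 (s≤s z≤n) n∸j≤1+n ⟩
    tupleSum (n ∸ j) (n ∸ j) (suc n) 1 0 0          ≡⟨ cong (λ k → tupleSum (n ∸ j) (n ∸ j) k 1 0 0) (ℕ.m+[n∸m]≡n n∸j≤1+n) ⟨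
    tupleSum (n ∸ j) (n ∸ j) (n ∸ j + d) 1 0 0      ≡⟨ tupleSum-+-length (n ∸ j) (n ∸ j) (n ∸ j) d 0 0 ℕ.≤-refl ⟩
    partitionSum (n ∸ j)                            ∎
    where
    open ≡-Reasoning
    d = suc n ∸ (n ∸ j)
    n∸j≤1+n : n ∸ j ≤ suc n
    n∸j≤1+n = ℕ.≤-trans (ℕ.m∸n≤m n j) (ℕ.n≤1+n n)

  partitionSum-suc : ∀ n → partitionSum (suc n) ≡ - ∑[ j < suc n ] (a (suc j) *ℚ partitionSum (n ∸ j))
  partitionSum-suc n = begin
    partitionSum (suc n)
      ≡⟨ Recurrence.tupleSum-recurrence (suc n) (suc n) ℕ.≤-refl (suc n) 1 0 0 (s≤s z≤n) ⟩
    0ℚ +ℚ (- ∑[ j < suc n ] (a (suc j) *ℚ tupleSum (suc n) (suc n) (suc n) 1 (suc j) 0))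
      ≡⟨ ℚ.+-identityˡ _ ⟩
    - ∑[ j < suc n ] (a (suc j) *ℚ tupleSum (suc n) (suc n) (suc n) 1 (suc j) 0)
      ≡⟨ cong -_ (∑-cong (suc n) (λ j j<1+n → cong (a (suc j) *ℚ_) (partitionSum-lowered n j (ℕ.≤-pred j<1+n)))) ⟩
    - ∑[ j < suc n ] (a (suc j) *ℚ partitionSum (n ∸ j)) ∎
    where open ≡-Reasoning

  partitionSum≡invSeries : ∀ n → partitionSum n ≡ invSeries a n
  partitionSum≡invSeries = invSeries-unique a partitionSum refl partitionSum-suc

open TupleSum using (expProduct; tupleWeight; sumℚ-tupleWeight; partitionSum; partitionSum≡invSeries)

tabulate-+toℕ : ∀ k s → Vec.tabulate (λ (j : Fin k) → s + toℕ j) ≡ Vec.iterate suc s k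
tabulate-+toℕ zero    s = refl
tabulate-+toℕ (suc k) s = cong₂ _∷_ (ℕ.+-identityʳ s)
  (trans (Vec.tabulate-cong (λ j → ℕ.+-suc s (toℕ j))) (tabulate-+toℕ k (suc s)))

prodℚ-invFact-powers : ∀ s {k} (t : Vec ℕ k) →
  prodℚ (Vec.toList (Vec.map invFact t)) *ℚ prodℚ (Vec.toList (Vec.zipWith (λ i tᵢ → invFact (2 * i) ^ℚ tᵢ) (Vec.iterate suc s k) t))
  ≡ expProduct coshSqrtCoeff s t
prodℚ-invFact-powers s []      = refl
prodℚ-invFact-powers s (x ∷ t) = begin
  (invFact x *ℚ P) *ℚ (A *ℚ Q)   ≡⟨ solve 4 (λ J P A Q → (J :* P) :* (A :* Q) := (A :* J) :* (P :* Q)) refl (invFact x) P A Q ⟩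
  (A *ℚ invFact x) *ℚ (P *ℚ Q)   ≡⟨ cong ((A *ℚ invFact x) *ℚ_) (prodℚ-invFact-powers (suc s) t) ⟩
  (A *ℚ invFact x) *ℚ expProduct coshSqrtCoeff (suc s) t ∎
  where
  open ≡-Reasoning
  A = coshSqrtCoeff s ^ℚ x
  P = prodℚ (Vec.toList (Vec.map invFact t))
  Q = prodℚ (Vec.toList (Vec.zipWith (λ i tᵢ → invFact (2 * i) ^ℚ tᵢ) (Vec.iterate suc (suc s) _) t))

summand-expProduct : ∀ n (t : Vec ℕ n) →
  summand n t ≡ ℕ→ℚ ((Vec.sum t + 0) !) *ℚ ((- 1ℚ) ^ℚ Vec.sum t *ℚ expProduct coshSqrtCoeff 1 t)
summand-expProduct n t = begin
  F *ℚ P *ℚ σ *ℚ prodℚ (Vec.toList (Vec.zipWith f (Vec.tabulate (λ (j : Fin n) → suc (toℕ j))) t))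
    ≡⟨ cong (λ v → F *ℚ P *ℚ σ *ℚ prodℚ (Vec.toList (Vec.zipWith f v t))) (tabulate-+toℕ n 1) ⟩
  F *ℚ P *ℚ σ *ℚ Q
    ≡⟨ solve 4 (λ F P σ Q → F :* P :* σ :* Q := F :* (σ :* (P :* Q))) refl F P σ Q ⟩
  F *ℚ (σ *ℚ (P *ℚ Q))
    ≡⟨ cong₂ (λ N z → ℕ→ℚ (N !) *ℚ (σ *ℚ z)) (sym (ℕ.+-identityʳ (Vec.sum t))) (prodℚ-invFact-powers 1 t) ⟩
  ℕ→ℚ ((Vec.sum t + 0) !) *ℚ (σ *ℚ expProduct coshSqrtCoeff 1 t) ∎
  where
  open ≡-Reasoning
  f : ℕ → ℕ → ℚ
  f i tᵢ = invFact (2 * i) ^ℚ tᵢ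
  F = ℕ→ℚ (Vec.sum t !)
  P = prodℚ (Vec.toList (Vec.map invFact t))
  σ = (- 1ℚ) ^ℚ Vec.sum t
  Q = prodℚ (Vec.toList (Vec.zipWith f (Vec.iterate suc 1 n) t))

sumℚ-summand≡partitionSum : ∀ n → sumℚ (map (summand n) (tuples n)) ≡ partitionSum coshSqrtCoeff n
sumℚ-summand≡partitionSum n = begin
  sumℚ (map (summand n) (tuples n))
    ≡⟨ sumℚ-map-filter (λ t → wsum 1 t ≟ n) (summand n) (allVecs n n) ⟩
  sumℚ (map (λ t → 𝟙 (wsum 1 t ≟ n) *ℚ summand n t) (allVecs n n))
    ≡⟨ cong sumℚ (List.map-cong (λ t → cong (𝟙 (wsum 1 t ≟ n) *ℚ_) (summand-expProduct n t)) (allVecs n n)) ⟩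
  sumℚ (map (tupleWeight coshSqrtCoeff n 1 0 0) (allVecs n n))
    ≡⟨ sumℚ-tupleWeight coshSqrtCoeff n n n 1 0 0 ⟩
  partitionSum coshSqrtCoeff n ∎
  where open ≡-Reasoning

Mmat≡hessenberg : ∀ n (i j : Fin n) → Mmat n i j ≡ hessenberg (invSeries coshSqrtCoeff) 1 (toℕ i) (toℕ j)
Mmat≡hessenberg n i j with toℕ j ≤? toℕ i
... | yes j≤i = begin
  Euler m *ℚ invFact m                       ≡⟨ Euler*invFact m ⟩
  invSeries coshCoeff m                      ≡⟨ invSeries-cosh-even (toℕ i ∸ toℕ j + 1) ⟩
  invSeries coshSqrtCoeff (toℕ i ∸ toℕ j + 1) ≡⟨ hessenberg-lower (invSeries coshSqrtCoeff) (toℕ i) (toℕ j) j≤i ⟨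
  hessenberg (invSeries coshSqrtCoeff) 1 (toℕ i) (toℕ j) ∎
  where
  open ≡-Reasoning
  m = 2 * (toℕ i ∸ toℕ j + 1)
... | no j≰i with toℕ j ≟ suc (toℕ i)
...   | yes j≡1+i = sym (trans (cong (hessenberg (invSeries coshSqrtCoeff) 1 (toℕ i)) j≡1+i)
                               (hessenberg-superdiagonal (invSeries coshSqrtCoeff) 1 (toℕ i)))
...   | no j≢1+i = sym (hessenberg-upper (invSeries coshSqrtCoeff) 1 (toℕ i) (toℕ j) 2+i≤j)
  where
  2+i≤j : suc (suc (toℕ i)) ≤ toℕ j
  2+i≤j with ℕ.m≤n⇒m<n∨m≡n (ℕ.≰⇒> j≰i)
  ... | inj₁ 1+i<j  = 1+i<j
  ... | inj₂ 1+i≡j = ⊥-elim (j≢1+i (sym 1+i≡j))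

corollary1 : (n : ℕ) → 1 ≤ n →
    (Euler (2 * n) ≡ ℕ→ℚ ((2 * n) !) *ℚ sumℚ (map (summand n) (tuples n)))
    × ((- 1ℚ) ^ℚ n *ℚ invFact (2 * n) ≡ det n (Mmat n))
corollary1 (suc n) _ = euler , determinant
  where
  open ≡-Reasoning
  euler : Euler (2 * suc n) ≡ ℕ→ℚ ((2 * suc n) !) *ℚ sumℚ (map (summand (suc n)) (tuples (suc n)))
  euler = cong (ℕ→ℚ ((2 * suc n) !) *ℚ_) (begin
    invSeries coshCoeff (2 * suc n)              ≡⟨ invSeries-cosh-even (suc n) ⟩
    invSeries coshSqrtCoeff (suc n)              ≡⟨ partitionSum≡invSeries coshSqrtCoeff (suc n) ⟨
    partitionSum coshSqrtCoeff (suc n)           ≡⟨ sumℚ-summand≡partitionSum (suc n) ⟨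
    sumℚ (map (summand (suc n)) (tuples (suc n))) ∎)
  determinant : (- 1ℚ) ^ℚ suc n *ℚ invFact (2 * suc n) ≡ det (suc n) (Mmat (suc n))
  determinant = sym (begin
    det (suc n) (Mmat (suc n))                      ≡⟨ det-cong (suc n) (Mmat≡hessenberg (suc n)) ⟩
    hessenbergDet (invSeries coshSqrtCoeff) 1 (suc n) ≡⟨ hessenbergDet-invSeries-1 coshSqrtCoeff refl n ⟩
    (- 1ℚ) ^ℚ suc n *ℚ invFact (2 * suc n)          ∎)
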